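{- For any $k\geq 1$, the number of unlabeled connected $k$-vertex graphs with at most $k-1+ \frac{k}{\ln k}$ edges is less than $100^k$.
   Context: "Unlabeled" means counted up to isomorphism. For $k=1$, $\frac{k}{\ln k}$ is interpreted as $+\infty$ (the statement is then about the single one-vertex graph). -}

module Defs where

open import Data.Nat using (ℕ; zero; suc; _+_; _*_; _∸_; _^_; _≤_; _<_; _<?_)
open import Data.Nat using (_!)
open import Data.Nat.ListAction using (sum)
open import Data.Bool using (Bool; true; false; if_then_else_)
open import Data.Fin using (Fin; toℕ)
open import Data.List using (List; []; _∷_; map; allFin; length)
open import Data.Product using (Σ; ∃; _×_)
open import Function.Bundles using (_↔_; Inverse)
open import Relation.Binary.PropositionalEquality using (_≡_)
open import Relation.Nullary using (¬_; does)

record Graph (k : ℕ) : Set where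
  field
    adj    : Fin k → Fin k → Bool
    sym    : ∀ i j → adj i j ≡ adj j i
    irrefl : ∀ i → adj i i ≡ false
open Graph public

edgeCount : ∀ {k} → Graph k → ℕ
edgeCount {k} G =
  sum (map (λ i → sum (map (λ j →
         if does (toℕ j <? toℕ i) then (if adj G i j then 1 else 0) else 0)
       (allFin k))) (allFin k))

data Reach {k : ℕ} (G : Graph k) : Fin k → Fin k → Set where
  here : ∀ {i} → Reach G i i
  step : ∀ {i l j} → adj G i l ≡ true → Reach G l j → Reach G i j

Connected : ∀ {k} → Graph k → Set
Connected {k} G = ∀ (i j : Fin k) → Reach G i j

Iso : ∀ {k} → Graph k → Graph k → Set
Iso {k} G H = Σ (Fin k ↔ Fin k) λ σ →
  ∀ i j → adj G i j ≡ adj H (Inverse.to σ i) (Inverse.to σ j)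

-- expNum k N = N! * Σ_{j=0}^{N} k^j / j!  (a natural number)
expNum : ℕ → ℕ → ℕ
expNum k zero    = 1
expNum k (suc N) = suc N * expNum k N + k ^ suc N

-- "x < e^k" for a natural x: some partial sum of the exponential series exceeds x
-- (the partial sums increase strictly to e^k).
LtExp : ℕ → ℕ → Set
LtExp x k = ∃ λ N → x * (N !) < expNum k N

-- e ≤ k - 1 + k / ln k   (for k = 1 the bound is +∞).
-- With m = e ∸ (k ∸ 1): for e ≤ k-1 it holds trivially (m = 0, 1 < e^k);
-- otherwise it is m ≤ k / ln k ⟺ m ln k ≤ k ⟺ k^m ≤ e^k ⟺ k^m < e^k
-- (e^k is irrational for k ≥ 1).
EdgeBound : ℕ → ℕ → Set
EdgeBound k e = LtExp (k ^ (e ∸ (k ∸ 1))) k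

Counted : ∀ {k} → Graph k → Set
Counted {k} G = Connected G × EdgeBound k (edgeCount G)

-- Number the vertices of a connected graph in breadth-first order from a root. Every
-- other vertex then has its parent among the earlier vertices and the parents form a
-- nondecreasing sequence, one of at most 2^(2k-1). The remaining m = e - (k - 1) edges
-- are listed as pairs of new labels; the edge bound reads k^m < e^k, and e^k < 4^k, so
-- m < 2k and for each m there are at most (k^2)^m < 16^k such lists. Parents and extra
-- edges determine the relabelled graph, so non-isomorphic graphs get distinct codes,
-- and there are at most k 64^k < 100^k codes.

module Submission where

open import Defs
open import Data.Nat using (ℕ; _≥_; _<_; _^_)
open import Data.List using (List; length)
open import Data.List.Relation.Unary.All using (All)
open import Data.List.Relation.Unary.AllPairs using (AllPairs)
open import Relation.Nullary using (¬_)

open import Data.Bool using (true; false; if_then_else_)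
import Data.Bool.Properties as Boolₚ
open import Data.Empty using (⊥-elim)
open import Data.Fin using (Fin; zero; suc; toℕ; fromℕ<; punchOut)
import Data.Fin.Properties as Finₚ
open Finₚ using (toℕ-injective; toℕ<n; toℕ-fromℕ<)
open import Data.Nat
open import Data.Nat.ListAction using (sum)
open import Data.Nat.Properties
open import Data.Nat.Tactic.RingSolver using (solve-∀)
open import Data.Product using (Σ; ∃; ∃₂; _×_; _,_; proj₁; proj₂; swap)
import Data.Product.Properties as ×
open import Data.Sum using (_⊎_; inj₁; inj₂)
open import Data.List
  using ([]; _∷_; _++_; [_]; map; filter; tabulate; allFin; upTo; concatMap; cartesianProductWith; cartesianProduct)
import Data.List.Properties as Listₚ
open Listₚ using (length-++; length-map; length-filter; filter-notAll; filter-++)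
open import Data.List.Membership.Propositional using (_∈_; lose)
open import Data.List.Membership.Propositional.Properties
  using (∈-filter⁺; ∈-filter⁻; ∈-map⁺; ∈-map⁻; ∈-++⁺ˡ; ∈-++⁺ʳ; ∈-allFin; ∈-upTo⁺; ∈-concatMap⁺;
         ∈-cartesianProductWith⁺; ∈-cartesianProduct⁺)
open import Data.List.Relation.Binary.Subset.Propositional using (_⊆_)
open import Data.List.Relation.Unary.All as All using ([]; _∷_; reduce)
open import Data.List.Relation.Unary.All.Properties using (all-filter; tabulate⁺)
open import Data.List.Relation.Unary.AllPairs using ([]; _∷_)
import Data.List.Relation.Unary.AllPairs.Properties as AllPairsₚ
open import Data.List.Relation.Unary.Any as Any using (here; there)
open import Data.List.Relation.Unary.Linked using (Linked; _∷_)
open import Data.List.Relation.Unary.Linked.Properties using (AllPairs⇒Linked)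
open import Data.List.Relation.Unary.Unique.Propositional using (Unique)
import Data.List.Relation.Unary.Unique.Propositional.Properties as Unique
open import Data.Vec.Functional using (updateAt)
open import Data.Vec.Functional.Properties using (updateAt-updates; updateAt-minimal)
open import Function using (_∘_; const)
open import Function.Bundles using (_↔_; Inverse; mk↔ₛ′; _⇔_; mk⇔)
open import Function.Construct.Composition using (_↔-∘_)
open import Function.Construct.Symmetry using (↔-sym)
open import Function.Definitions using (Injective)
import Function.Properties.Equivalence as ⇔
open import Level using (Level)
open import Relation.Binary.Core using (Rel)
open import Relation.Binary.Definitions using (DecidableEquality; tri<; tri≈; tri>)
open import Relation.Nullary using (yes; no; ¬?; does; _×-dec_; contradiction)
open import Relation.Unary using (Pred; Decidable)
import Relation.Binary.PropositionalEquality as ≡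
open ≡ using (_≡_; _≢_; refl; cong; cong₂; subst; module ≡-Reasoning)

private
  variable
    ℓ ℓ′ ℓ₁ ℓ₂ : Level
    A : Set ℓ
    B : Set ℓ′
    k n : ℕ
    G H : Graph k

-- The exponential series: e^k < 4^k

^-distribʳ-* : ∀ m n o → (m * n) ^ o ≡ m ^ o * n ^ o
^-distribʳ-* m n zero    = refl
^-distribʳ-* m n (suc o) = begin
  m * n * (m * n) ^ o     ≡⟨ cong (m * n *_) (^-distribʳ-* m n o) ⟩
  m * n * (m ^ o * n ^ o) ≡⟨ interchange m n (m ^ o) (n ^ o) ⟩
  m * m ^ o * (n * n ^ o) ∎
  where
  open ≡-Reasoning
  interchange : ∀ a b c d → a * b * (c * d) ≡ a * c * (b * d)
  interchange = solve-∀

-- latticePaths r j = C(r + j, j).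
latticePaths : ℕ → ℕ → ℕ
latticePaths zero    j       = 1
latticePaths (suc r) zero    = 1
latticePaths (suc r) (suc j) = latticePaths r (suc j) + latticePaths (suc r) j

-- heavyWords r N counts the 0/1-words of length r + 1 + N with at least r + 1 ones
-- (split on the first letter); it equals Σ_{j ≤ N} C(r + j, j) 2^(N - j).
heavyWords : ℕ → ℕ → ℕ
heavyWords r       zero    = 1
heavyWords zero    (suc N) = 2 * heavyWords zero N + 1
heavyWords (suc r) (suc N) = heavyWords r (suc N) + heavyWords (suc r) N

heavyWords<2^ : ∀ r N → heavyWords r N < 2 ^ (suc r + N)
heavyWords<2^ zero    zero    = s≤s (s≤s z≤n)
heavyWords<2^ zero    (suc N) = begin-strict
  2 * h + 1      <⟨ +-monoʳ-< (2 * h) (n<1+n 1) ⟩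
  2 * h + 2      ≡⟨ +-comm (2 * h) 2 ⟩
  2 + 2 * h      ≡⟨ *-suc 2 h ⟨
  2 * suc h      ≤⟨ *-monoʳ-≤ 2 (heavyWords<2^ zero N) ⟩
  2 * 2 ^ suc N  ∎
  where
  open ≤-Reasoning
  h = heavyWords zero N
heavyWords<2^ (suc r) zero    = *-monoʳ-≤ 2 (m^n>0 2 (suc r + 0))
heavyWords<2^ (suc r) (suc N) = begin-strict
  heavyWords r (suc N) + heavyWords (suc r) N <⟨ +-mono-< (heavyWords<2^ r (suc N)) (heavyWords<2^ (suc r) N) ⟩
  2 ^ (suc r + suc N) + 2 ^ (suc (suc r) + N) ≡⟨ cong (λ e → 2 ^ (suc r + suc N) + 2 ^ e) (+-suc (suc r) N) ⟨
  2 ^ (suc r + suc N) + 2 ^ (suc r + suc N)   ≡⟨ cong (2 ^ (suc r + suc N) +_) (+-identityʳ _) ⟨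
  2 * 2 ^ (suc r + suc N)                     ∎
  where open ≤-Reasoning

heavyWords-suc : ∀ r N → heavyWords r (suc N) ≡ 2 * heavyWords r N + latticePaths r (suc N)
heavyWords-suc zero    N       = refl
heavyWords-suc (suc r) zero    = begin
  heavyWords r 1 + 1                 ≡⟨ cong (_+ 1) (heavyWords-suc r zero) ⟩
  2 * 1 + latticePaths r 1 + 1       ≡⟨ +-assoc 2 (latticePaths r 1) 1 ⟩
  2 * 1 + (latticePaths r 1 + 1)     ∎
  where open ≡-Reasoning
heavyWords-suc (suc r) (suc N) = begin
  heavyWords r (suc (suc N)) + heavyWords (suc r) (suc N)
    ≡⟨ cong₂ _+_ (heavyWords-suc r (suc N)) (heavyWords-suc (suc r) N) ⟩
  2 * a + b + (2 * c + d)
    ≡⟨ regroup a b c d ⟩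
  2 * (a + c) + (b + d) ∎
  where
  open ≡-Reasoning
  a = heavyWords r (suc N)
  b = latticePaths r (suc (suc N))
  c = heavyWords (suc r) N
  d = latticePaths (suc r) (suc N)
  regroup : ∀ a b c d → 2 * a + b + (2 * c + d) ≡ 2 * (a + c) + (b + d)
  regroup = solve-∀

latticePaths-zeroʳ : ∀ r → latticePaths r 0 ≡ 1
latticePaths-zeroʳ zero    = refl
latticePaths-zeroʳ (suc r) = refl

latticePaths-absorb : ∀ r N → suc N * latticePaths r (suc N) ≡ (r + suc N) * latticePaths r N
latticePaths-absorb zero    N       = refl
latticePaths-absorb (suc r) zero    = begin
  1 * (latticePaths r 1 + 1)  ≡⟨ *-identityˡ _ ⟩
  latticePaths r 1 + 1        ≡⟨ cong (_+ 1) (≡.trans (≡.sym (*-identityˡ _)) (latticePaths-absorb r zero)) ⟩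
  (r + 1) * latticePaths r 0 + 1 ≡⟨ cong (λ x → (r + 1) * x + 1) (latticePaths-zeroʳ r) ⟩
  (r + 1) * 1 + 1             ≡⟨ normalise r ⟩
  (suc r + 1) * 1             ∎
  where
  open ≡-Reasoning
  normalise : ∀ r → (r + 1) * 1 + 1 ≡ (suc r + 1) * 1
  normalise = solve-∀
latticePaths-absorb (suc r) (suc N) = begin
  suc (suc N) * (b + (a + d))
    ≡⟨ expand N b a d ⟩
  suc (suc N) * b + suc N * (a + d) + (a + d)
    ≡⟨ cong₂ (λ x y → x + y + (a + d)) (latticePaths-absorb r (suc N)) (latticePaths-absorb (suc r) N) ⟩
  (r + suc (suc N)) * a + (suc r + suc N) * d + (a + d)
    ≡⟨ collect N r a d ⟩
  (suc r + suc (suc N)) * (a + d) ∎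
  where
  open ≡-Reasoning
  a = latticePaths r (suc N)
  b = latticePaths r (suc (suc N))
  d = latticePaths (suc r) N
  expand : ∀ N b a d → suc (suc N) * (b + (a + d)) ≡ suc (suc N) * b + suc N * (a + d) + (a + d)
  expand = solve-∀
  collect : ∀ N r a d → (r + suc (suc N)) * a + (suc r + suc N) * d + (a + d) ≡ (suc r + suc (suc N)) * (a + d)
  collect = solve-∀

^≤!*latticePaths : ∀ r N → suc r ^ N ≤ N ! * latticePaths r N
^≤!*latticePaths r zero    = ≤-reflexive (cong (_+ 0) (≡.sym (latticePaths-zeroʳ r)))
^≤!*latticePaths r (suc N) = begin
  suc r * suc r ^ N                    ≤⟨ *-mono-≤ (m≤m+n (suc r) N) (^≤!*latticePaths r N) ⟩
  (suc r + N) * (N ! * p)              ≡⟨ cong (λ m → m * (N ! * p)) (+-suc r N) ⟨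
  (r + suc N) * (N ! * p)              ≡⟨ x*[y*z]≡y*[x*z] (r + suc N) (N !) p ⟩
  N ! * ((r + suc N) * p)              ≡⟨ cong (N ! *_) (latticePaths-absorb r N) ⟨
  N ! * (suc N * latticePaths r (suc N)) ≡⟨ x*[y*z]≡y*[x*z] (N !) (suc N) _ ⟩
  suc N * (N ! * latticePaths r (suc N)) ≡⟨ *-assoc (suc N) (N !) _ ⟨
  suc N ! * latticePaths r (suc N)     ∎
  where
  open ≤-Reasoning
  p = latticePaths r N
  x*[y*z]≡y*[x*z] : ∀ x y z → x * (y * z) ≡ y * (x * z)
  x*[y*z]≡y*[x*z] = solve-∀

-- Σ_{j ≤ N} k^j / j! = Σ_{j ≤ N} (2k)^j 2^-j / j! ≤ Σ_{j ≤ N} C(2k - 1 + j, j) 2^-j,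
-- cleared of denominators.
expNum*2^≤ : ∀ {k r} → 2 * k ≡ suc r → ∀ N → expNum k N * 2 ^ N ≤ N ! * heavyWords r N
expNum*2^≤ _ zero = ≤-refl
expNum*2^≤ {k} {r} 2k≡1+r (suc N) = begin
  (suc N * E + k ^ suc N) * (2 * 2 ^ N)
    ≡⟨ expand (suc N) E (k ^ suc N) (2 ^ N) ⟩
  2 * suc N * (E * 2 ^ N) + 2 ^ suc N * k ^ suc N
    ≡⟨ cong (2 * suc N * (E * 2 ^ N) +_) (^-distribʳ-* 2 k (suc N)) ⟨
  2 * suc N * (E * 2 ^ N) + (2 * k) ^ suc N
    ≡⟨ cong (λ m → 2 * suc N * (E * 2 ^ N) + m ^ suc N) 2k≡1+r ⟩
  2 * suc N * (E * 2 ^ N) + suc r ^ suc N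
    ≤⟨ +-mono-≤ (*-monoʳ-≤ (2 * suc N) (expNum*2^≤ 2k≡1+r N)) (^≤!*latticePaths r (suc N)) ⟩
  2 * suc N * (N ! * heavyWords r N) + suc N ! * latticePaths r (suc N)
    ≡⟨ collect (suc N) (N !) (heavyWords r N) (latticePaths r (suc N)) ⟩
  suc N ! * (2 * heavyWords r N + latticePaths r (suc N))
    ≡⟨ cong (suc N ! *_) (heavyWords-suc r N) ⟨
  suc N ! * heavyWords r (suc N) ∎
  where
  open ≤-Reasoning
  E = expNum k N
  expand : ∀ n e p t → (n * e + p) * (2 * t) ≡ 2 * n * (e * t) + 2 * t * p
  expand = solve-∀
  collect : ∀ n f a b → 2 * n * (f * a) + n * f * b ≡ n * f * (2 * a + b)
  collect = solve-∀

expNum<!*4^ : ∀ k N → expNum (suc k) N < N ! * 4 ^ suc k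
expNum<!*4^ k N = *-cancelʳ-< (2 ^ N) _ _ (begin-strict
  expNum (suc k) N * 2 ^ N     ≤⟨ expNum*2^≤ 2k≡1+r N ⟩
  N ! * heavyWords r N         <⟨ *-monoʳ-< (N !) {{N !≢0}} (heavyWords<2^ r N) ⟩
  N ! * 2 ^ (suc r + N)        ≡⟨ cong (N ! *_) (^-distribˡ-+-* 2 (suc r) N) ⟩
  N ! * (2 ^ suc r * 2 ^ N)    ≡⟨ cong (λ e → N ! * (2 ^ e * 2 ^ N)) 2k≡1+r ⟨
  N ! * (2 ^ (2 * suc k) * 2 ^ N) ≡⟨ cong (λ m → N ! * (m * 2 ^ N)) (^-*-assoc 2 2 (suc k)) ⟨
  N ! * (4 ^ suc k * 2 ^ N)    ≡⟨ *-assoc (N !) (4 ^ suc k) (2 ^ N) ⟨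
  N ! * 4 ^ suc k * 2 ^ N      ∎)
  where
  open ≤-Reasoning
  r = suc (2 * k)
  2k≡1+r : 2 * suc k ≡ suc r
  2k≡1+r = *-suc 2 k

LtExp⇒<4^ : ∀ {x k} → LtExp x (suc k) → x < 4 ^ suc k
LtExp⇒<4^ {x} {k} (N , x*N!<expNum) = *-cancelʳ-< (N !) x (4 ^ suc k) (begin-strict
  x * N !          <⟨ x*N!<expNum ⟩
  expNum (suc k) N <⟨ expNum<!*4^ k N ⟩
  N ! * 4 ^ suc k  ≡⟨ *-comm (N !) _ ⟩
  4 ^ suc k * N !  ∎)
  where open ≤-Reasoning

^<4^⇒< : ∀ {k m} → 2 ≤ k → k ^ m < 4 ^ k → m < 2 * k
^<4^⇒< {k} {m} 2≤k k^m<4^k = ≰⇒> λ 2k≤m → <⇒≱ k^m<4^k (begin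
  4 ^ k       ≡⟨ ^-*-assoc 2 2 k ⟩
  2 ^ (2 * k) ≤⟨ ^-monoʳ-≤ 2 2k≤m ⟩
  2 ^ m       ≤⟨ ^-monoˡ-≤ m 2≤k ⟩
  k ^ m       ∎)
  where open ≤-Reasoning

*64^<100^ : ∀ n → suc n * 64 ^ suc n < 100 ^ suc n
*64^<100^ zero          = <ᵇ⇒< 64 100 _
*64^<100^ (suc zero)    = <ᵇ⇒< 8192 10000 _
*64^<100^ (suc (suc m)) = begin-strict
  (3 + m) * (64 * X)      ≡⟨ expand m X ⟩
  (64 * m + 192) * X      ≤⟨ *-monoˡ-≤ X (+-monoˡ-≤ 192 (*-monoˡ-≤ m (≤ᵇ⇒≤ 64 96 _))) ⟩
  (96 * m + 192) * X      ≡⟨ collect m X ⟩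
  96 * ((2 + m) * X)      <⟨ *-monoʳ-< 96 (*64^<100^ (suc m)) ⟩
  96 * 100 ^ (2 + m)      ≤⟨ *-monoˡ-≤ (100 ^ (2 + m)) (≤ᵇ⇒≤ 96 100 _) ⟩
  100 * 100 ^ (2 + m)     ∎
  where
  open ≤-Reasoning
  X = 64 ^ (2 + m)
  expand : ∀ m X → (3 + m) * (64 * X) ≡ (64 * m + 192) * X
  expand = solve-∀
  collect : ∀ m X → (96 * m + 192) * X ≡ 96 * ((2 + m) * X)
  collect = solve-∀

length-filter+length-filter-∁ : {P : Pred A ℓ₁} (P? : Decidable P) (xs : List A) →
  length (filter P? xs) + length (filter (¬? ∘ P?) xs) ≡ length xs
length-filter+length-filter-∁ P? []       = refl
length-filter+length-filter-∁ P? (x ∷ xs) with P? x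
... | yes _ = cong suc (length-filter+length-filter-∁ P? xs)
... | no  _ = ≡.trans (+-suc _ _) (cong suc (length-filter+length-filter-∁ P? xs))

Unique⇒length≤ : DecidableEquality A → {xs ys : List A} → Unique xs → xs ⊆ ys → length xs ≤ length ys
Unique⇒length≤ _≟_ {[]}     _            _      = z≤n
Unique⇒length≤ _≟_ {x ∷ xs} {ys} (x∉xs ∷ u) x∷xs⊆ys = begin-strict
  length xs                                ≤⟨ Unique⇒length≤ _≟_ u xs⊆ys-x ⟩
  length (filter (λ y → ¬? (x ≟ y)) ys)    <⟨ filter-notAll _ ys (Any.map contradiction (x∷xs⊆ys (here refl))) ⟩
  length ys                                ∎
  where
  open ≤-Reasoning
  xs⊆ys-x : xs ⊆ filter (λ y → ¬? (x ≟ y)) ys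
  xs⊆ys-x y∈xs = ∈-filter⁺ _ (x∷xs⊆ys (there y∈xs)) (All.lookup x∉xs y∈xs)

module _ {P : Pred A ℓ₁} (f : ∀ {x} → P x → B) where

  length-reduce : ∀ {xs} (pxs : All P xs) → length (reduce f pxs) ≡ length xs
  length-reduce []         = refl
  length-reduce (px ∷ pxs) = cong suc (length-reduce pxs)

  All-reduce⁺ : {Q : Pred B ℓ₂} → (∀ {x} (px : P x) → Q (f px)) →
    ∀ {xs} (pxs : All P xs) → All Q (reduce f pxs)
  All-reduce⁺ q []         = []
  All-reduce⁺ q (px ∷ pxs) = q px ∷ All-reduce⁺ q pxs

  AllPairs-reduce⁺ : {R : Rel A ℓ₁} {S : Rel B ℓ₂} →
    (∀ {x y} (px : P x) (py : P y) → R x y → S (f px) (f py)) →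
    ∀ {xs} (pxs : All P xs) → AllPairs R xs → AllPairs S (reduce f pxs)
  AllPairs-reduce⁺ r⇒s []         []            = []
  AllPairs-reduce⁺ r⇒s (px ∷ pxs) (Rxs ∷ Rxss) =
    head⁺ Rxs pxs ∷ AllPairs-reduce⁺ r⇒s pxs Rxss
    where
    head⁺ : ∀ {ys} → All _ ys → (pys : All P ys) → All _ (reduce f pys)
    head⁺ []          []         = []
    head⁺ (Rxy ∷ Rys) (py ∷ pys) = r⇒s px py Rxy ∷ head⁺ Rys pys

  labelling⇒length≤ : {R : Rel A ℓ₁} → DecidableEquality B →
    (∀ {x y} (px : P x) (py : P y) → f px ≡ f py → R x y) →
    ∀ {xs ys} → (∀ {x} (px : P x) → f px ∈ ys) →
    All P xs → AllPairs (λ x y → ¬ R x y) xs → length xs ≤ length ys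
  labelling⇒length≤ _≟_ reflects {xs} {ys} into pxs ¬Rs = begin
    length xs              ≡⟨ length-reduce pxs ⟨
    length (reduce f pxs)  ≤⟨ Unique⇒length≤ _≟_ unique (All.lookup (All-reduce⁺ into pxs)) ⟩
    length ys              ∎
    where
    open ≤-Reasoning
    unique : Unique (reduce f pxs)
    unique = AllPairs-reduce⁺ (λ px py ¬R fx≡fy → ¬R (reflects px py fx≡fy)) pxs ¬Rs

length-concatMap≤ : (f : A → List B) (c : ℕ) {xs : List A} →
  (∀ {x} → x ∈ xs → length (f x) ≤ c) → length (concatMap f xs) ≤ length xs * c
length-concatMap≤ f c {[]}     _     = z≤n
length-concatMap≤ f c {x ∷ xs} bound = begin
  length (f x ++ concatMap f xs)          ≡⟨ length-++ (f x) ⟩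
  length (f x) + length (concatMap f xs)  ≤⟨ +-mono-≤ (bound (here refl)) (length-concatMap≤ f c (bound ∘ there)) ⟩
  c + length xs * c                       ∎
  where open ≤-Reasoning

length-cartesianProductWith : ∀ {c} {C : Set c} (f : A → B → C) xs ys →
  length (cartesianProductWith f xs ys) ≡ length xs * length ys
length-cartesianProductWith f []       ys = refl
length-cartesianProductWith f (x ∷ xs) ys = ≡.trans (length-++ (map (f x) ys))
  (≡.cong₂ _+_ (length-map (f x) ys) (length-cartesianProductWith f xs ys))

tabulate-injective : {f g : Fin k → A} → tabulate f ≡ tabulate g → ∀ i → f i ≡ g i
tabulate-injective {k = suc k} same zero    = Listₚ.∷-injectiveˡ same
tabulate-injective {k = suc k} same (suc i) = tabulate-injective (Listₚ.∷-injectiveʳ same) i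

length-allFin : ∀ k → length (allFin k) ≡ k
length-allFin k = Listₚ.length-tabulate {n = k} (λ i → i)

lists : ℕ → List A → List (List A)
lists zero    xs = [ [] ]
lists (suc m) xs = cartesianProductWith _∷_ xs (lists m xs)

length-lists : ∀ m (xs : List A) → length (lists m xs) ≡ length xs ^ m
length-lists zero    xs = refl
length-lists (suc m) xs = ≡.trans (length-cartesianProductWith _∷_ xs (lists m xs))
  (cong (length xs *_) (length-lists m xs))

∈-lists⁺ : {xs zs : List A} → All (_∈ xs) zs → zs ∈ lists (length zs) xs
∈-lists⁺ []           = here refl
∈-lists⁺ (z∈xs ∷ zs∈) = ∈-cartesianProductWith⁺ _∷_ z∈xs (∈-lists⁺ zs∈)

sortedLists : ℕ → ℕ → ℕ → List (List ℕ)
sortedLists lo d       zero    = [ [] ]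
sortedLists lo zero    (suc n) = map (lo ∷_) (sortedLists lo zero n)
sortedLists lo (suc d) (suc n) = map (lo ∷_) (sortedLists lo (suc d) n) ++ sortedLists (suc lo) d (suc n)

length-sortedLists≤ : ∀ lo d n → length (sortedLists lo d n) ≤ 2 ^ (d + n)
length-sortedLists≤ lo d       zero    = m^n>0 2 (d + 0)
length-sortedLists≤ lo zero    (suc n) = begin
  length (map (lo ∷_) (sortedLists lo zero n)) ≡⟨ length-map (lo ∷_) (sortedLists lo zero n) ⟩
  length (sortedLists lo zero n)               ≤⟨ length-sortedLists≤ lo zero n ⟩
  2 ^ n                                        ≤⟨ m≤m+n (2 ^ n) _ ⟩
  2 * 2 ^ n                                    ∎
  where open ≤-Reasoning
length-sortedLists≤ lo (suc d) (suc n) = begin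
  length (map (lo ∷_) (sortedLists lo (suc d) n) ++ sortedLists (suc lo) d (suc n))
    ≡⟨ length-++ (map (lo ∷_) (sortedLists lo (suc d) n)) ⟩
  length (map (lo ∷_) (sortedLists lo (suc d) n)) + length (sortedLists (suc lo) d (suc n))
    ≡⟨ cong (_+ length (sortedLists (suc lo) d (suc n))) (length-map (lo ∷_) (sortedLists lo (suc d) n)) ⟩
  length (sortedLists lo (suc d) n) + length (sortedLists (suc lo) d (suc n))
    ≤⟨ +-mono-≤ (length-sortedLists≤ lo (suc d) n) (length-sortedLists≤ (suc lo) d (suc n)) ⟩
  2 ^ (suc d + n) + 2 ^ (d + suc n)
    ≡⟨ cong (λ e → 2 ^ (suc d + n) + 2 ^ e) (+-suc d n) ⟩
  2 ^ (suc d + n) + 2 ^ (suc d + n)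
    ≡⟨ cong (2 ^ (suc d + n) +_) (+-identityʳ _) ⟨
  2 * 2 ^ (suc d + n)
    ≡⟨ cong (2 ^_) (+-suc (suc d) n) ⟨
  2 ^ (suc d + suc n) ∎
  where open ≤-Reasoning

∈-sortedLists⁺ : ∀ {lo d xs} → Linked _≤_ (lo ∷ xs) → All (_≤ lo + d) xs → xs ∈ sortedLists lo d (length xs)
∈-sortedLists⁺ {xs = []} _ _ = here refl
∈-sortedLists⁺ {lo} {d} {x ∷ xs} (lo≤x ∷ sorted) (x≤ ∷ xs≤) with m≤n⇒m<n∨m≡n lo≤x | d
... | inj₂ refl | zero  = ∈-map⁺ (lo ∷_) (∈-sortedLists⁺ sorted xs≤)
... | inj₂ refl | suc _ = ∈-++⁺ˡ (∈-map⁺ (lo ∷_) (∈-sortedLists⁺ sorted xs≤))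
... | inj₁ lo<x | zero  = ⊥-elim (<⇒≱ lo<x (subst (x ≤_) (+-identityʳ lo) x≤))
... | inj₁ lo<x | suc d′ = ∈-++⁺ʳ (map (lo ∷_) (sortedLists lo (suc d′) (length xs)))
  (∈-sortedLists⁺ (lo<x ∷ sorted) (All.map (λ {y} → subst (y ≤_) (+-suc lo d′)) (x≤ ∷ xs≤)))

relabel : ∀ {m} → Graph m → (Fin k → Fin m) → Graph k
relabel G f = record
  { adj    = λ i j → adj G (f i) (f j)
  ; sym    = λ i j → Graph.sym G (f i) (f j)
  ; irrefl = λ i → irrefl G (f i)
  }

Iso-relabel : (G : Graph k) (π : Fin k ↔ Fin k) → Iso (relabel G (Inverse.to π)) G
Iso-relabel G π = π , λ i j → refl

relabelings⇒Iso : (G H : Graph k) (π ρ : Fin k ↔ Fin k) →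
  (∀ i j → adj (relabel G (Inverse.to π)) i j ≡ adj (relabel H (Inverse.to ρ)) i j) → Iso G H
relabelings⇒Iso G H π ρ same = ρ ↔-∘ ↔-sym π , λ i j → begin
  adj G i j                                     ≡⟨ cong₂ (adj G) (π.strictlyInverseˡ i) (π.strictlyInverseˡ j) ⟨
  adj G (π.to (π.from i)) (π.to (π.from j))     ≡⟨ same (π.from i) (π.from j) ⟩
  adj H (ρ.to (π.from i)) (ρ.to (π.from j))     ∎
  where
  module π = Inverse π
  module ρ = Inverse ρ
  open ≡-Reasoning

lowerAdj⇒≗ : (∀ {i j} → toℕ j < toℕ i → adj G i j ≡ adj H i j) → ∀ i j → adj G i j ≡ adj H i j
lowerAdj⇒≗ {G = G} {H = H} lower i j with <-cmp (toℕ i) (toℕ j)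
... | tri< i<j _ _ = ≡.trans (Graph.sym G i j) (≡.trans (lower i<j) (Graph.sym H j i))
... | tri≈ _ i≡j _ rewrite toℕ-injective i≡j = ≡.trans (irrefl G j) (≡.sym (irrefl H j))
... | tri> _ _ j<i = lower j<i

Reach-crossing : {G : Graph k} {P : Pred (Fin k) ℓ} → Decidable P → ∀ {a b} →
  P a → ¬ P b → Reach G a b → ∃₂ λ c d → P c × ¬ P d × adj G c d ≡ true
Reach-crossing P? Pa ¬Pb here = ⊥-elim (¬Pb Pa)
Reach-crossing P? {a} Pa ¬Pb (step {l = l} al reach) with P? l
... | yes Pl = Reach-crossing P? Pl ¬Pb reach
... | no ¬Pl = a , l , Pa , ¬Pl , al

pair≟ : DecidableEquality (Fin k × Fin k)
pair≟ = ×.≡-dec Finₚ._≟_ Finₚ._≟_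

IsEdge : Graph k → Fin k × Fin k → Set
IsEdge G (i , j) = toℕ j < toℕ i × adj G i j ≡ true

isEdge? : (G : Graph k) → Decidable (IsEdge G)
isEdge? G (i , j) = (toℕ j <? toℕ i) ×-dec (adj G i j Boolₚ.≟ true)

edges : Graph k → List (Fin k × Fin k)
edges {k} G = filter (isEdge? G) (cartesianProduct (allFin k) (allFin k))

∈-edges⁺ : ∀ {i j} → IsEdge G (i , j) → (i , j) ∈ edges G
∈-edges⁺ e = ∈-filter⁺ _ (∈-cartesianProduct⁺ (∈-allFin _) (∈-allFin _)) e

∈-edges⁻ : ∀ {e} → e ∈ edges G → IsEdge G e
∈-edges⁻ {k} {G = G} e∈ = proj₂ (∈-filter⁻ (isEdge? G) {xs = cartesianProduct (allFin k) (allFin k)} e∈)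

edges-unique : (G : Graph k) → Unique (edges G)
edges-unique {k} G = Unique.filter⁺ (isEdge? G) (Unique.cartesianProduct⁺ (Unique.allFin⁺ k) (Unique.allFin⁺ k))

edgeCount≡length-edges : (G : Graph k) → edgeCount G ≡ length (edges G)
edgeCount≡length-edges {k} G = ≡.sym (count (allFin k))
  where
  below : Fin k → Fin k → ℕ
  below i j = if does (toℕ j <? toℕ i) then (if adj G i j then 1 else 0) else 0
  row : ∀ i js → length (filter (isEdge? G) (map (i ,_) js)) ≡ sum (map (below i) js)
  row i []       = refl
  row i (j ∷ js) with toℕ j <ᵇ toℕ i | adj G i j
  ... | true  | true  = cong suc (row i js)
  ... | true  | false = row i js
  ... | false | _     = row i js
  count : ∀ is → length (filter (isEdge? G) (cartesianProduct is (allFin k)))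
               ≡ sum (map (λ i → sum (map (below i) (allFin k))) is)
  count []       = refl
  count (i ∷ is) = begin
    length (filter (isEdge? G) (map (i ,_) (allFin k) ++ cartesianProduct is (allFin k)))
      ≡⟨ cong length (filter-++ (isEdge? G) (map (i ,_) (allFin k)) _) ⟩
    length (filter (isEdge? G) (map (i ,_) (allFin k)) ++ filter (isEdge? G) (cartesianProduct is (allFin k)))
      ≡⟨ length-++ (filter (isEdge? G) (map (i ,_) (allFin k))) ⟩
    length (filter (isEdge? G) (map (i ,_) (allFin k))) + length (filter (isEdge? G) (cartesianProduct is (allFin k)))
      ≡⟨ cong₂ _+_ (row i (allFin k)) (count is) ⟩
    sum (map (below i) (allFin k)) + sum (map (λ i → sum (map (below i) (allFin k))) is) ∎
    where open ≡-Reasoning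

adj⇒≢ : ∀ {a b} → adj G a b ≡ true → a ≢ b
adj⇒≢ {G = G} ab refl with ≡.trans (≡.sym ab) (irrefl G _)
... | ()

orient : Fin k → Fin k → Fin k × Fin k
orient a b with toℕ b <? toℕ a
... | yes _ = a , b
... | no  _ = b , a

orient-cases : (a b : Fin k) → orient a b ≡ (a , b) ⊎ orient a b ≡ (b , a)
orient-cases a b with toℕ b <? toℕ a
... | yes _ = inj₁ refl
... | no  _ = inj₂ refl

orient-injective : {a b c d : Fin k} → orient a b ≡ orient c d → a ≡ c × b ≡ d ⊎ a ≡ d × b ≡ c
orient-injective {a = a} {b} {c} {d} eq with orient-cases a b | orient-cases c d
... | inj₁ o | inj₁ o′ = inj₁ (×.,-injective (≡.trans (≡.sym o) (≡.trans eq o′)))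
... | inj₁ o | inj₂ o′ = inj₂ (×.,-injective (≡.trans (≡.sym o) (≡.trans eq o′)))
... | inj₂ o | inj₁ o′ = inj₂ (swap (×.,-injective (≡.trans (≡.sym o) (≡.trans eq o′))))
... | inj₂ o | inj₂ o′ = inj₁ (swap (×.,-injective (≡.trans (≡.sym o) (≡.trans eq o′))))

orient-∈-edges : ∀ {a b} → adj G a b ≡ true → orient a b ∈ edges G
orient-∈-edges {G = G} {a} {b} ab with toℕ b <? toℕ a
... | yes b<a = ∈-edges⁺ {G = G} (b<a , ab)
... | no  b≮a = ∈-edges⁺ {G = G} (≤∧≢⇒< (≮⇒≥ b≮a) (adj⇒≢ {G = G} ab ∘ toℕ-injective) ,
                                 ≡.trans (Graph.sym G b a) ab)

Iso⇒edgeCount≤ : Iso G H → edgeCount G ≤ edgeCount H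
Iso⇒edgeCount≤ {G = G} {H = H} (σ , preserves) = begin
  edgeCount G           ≡⟨ edgeCount≡length-edges G ⟩
  length (edges G)      ≤⟨ labelling⇒length≤ image pair≟ image-injective image-∈
                             (all-filter (isEdge? G) (cartesianProduct (allFin _) (allFin _))) (edges-unique G) ⟩
  length (edges H)      ≡⟨ edgeCount≡length-edges H ⟨
  edgeCount H           ∎
  where
  open ≤-Reasoning
  open Inverse σ
  image : ∀ {e} → IsEdge G e → Fin _ × Fin _
  image {i , j} _ = orient (to i) (to j)
  image-∈ : ∀ {e} (e-edge : IsEdge G e) → image e-edge ∈ edges H
  image-∈ {i , j} (_ , ij) = orient-∈-edges {G = H} (≡.trans (≡.sym (preserves i j)) ij)
  to-injective : ∀ {x y} → to x ≡ to y → x ≡ y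
  to-injective {x} {y} tx≡ty = ≡.trans (≡.sym (strictlyInverseʳ x)) (≡.trans (cong from tx≡ty) (strictlyInverseʳ y))
  image-injective : ∀ {e e′} (e-edge : IsEdge G e) (e′-edge : IsEdge G e′) →
                    image e-edge ≡ image e′-edge → e ≡ e′
  image-injective {i , j} {i′ , j′} (j<i , _) (j′<i′ , _) same with orient-injective same
  ... | inj₁ (i≡i′ , j≡j′) = cong₂ _,_ (to-injective i≡i′) (to-injective j≡j′)
  ... | inj₂ (i≡j′ , j≡i′) with to-injective i≡j′ | to-injective j≡i′
  ...   | refl | refl = ⊥-elim (<-asym j<i j′<i′)

-- Breadth-first search

leastWitness : {P : Pred (Fin n) ℓ} → Decidable P → ∀ {i} → P i →
  ∃ λ j → toℕ j ≤ toℕ i × P j × (∀ {l} → toℕ l < toℕ j → ¬ P l)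
leastWitness {n = suc n} P? {i} Pi with P? zero | i
... | yes P0 | _     = zero , z≤n , P0 , λ ()
... | no ¬P0 | zero  = ⊥-elim (¬P0 Pi)
... | no ¬P0 | suc i with leastWitness (P? ∘ suc) Pi
...   | j , j≤i , Pj , below = suc j , s≤s j≤i , Pj , λ { {zero} _ → ¬P0 ; {suc l} (s≤s l<j) → below l<j }

-- if y were missed, punching it out of the codomain would inject Fin (suc n) into Fin n
injective⇒surjective : ∀ {f : Fin n → Fin n} → Injective _≡_ _≡_ f → ∀ y → ∃ λ x → f x ≡ y
injective⇒surjective {suc n} {f} f-injective y with Finₚ.any? (λ x → f x Finₚ.≟ y)
... | yes hit = hit
... | no miss = ⊥-elim (n≮n n (Finₚ.injective⇒≤ g-injective))
  where
  y≢f : ∀ x → ¬ y ≡ f x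
  y≢f x y≡fx = miss (x , ≡.sym y≡fx)
  g : Fin (suc n) → Fin n
  g x = punchOut (y≢f x)
  g-injective : ∀ {a b} → g a ≡ g b → a ≡ b
  g-injective ga≡gb = f-injective (Finₚ.punchOut-injective (y≢f _) (y≢f _) ga≡gb)

injective⇒↔ : (f : Fin n → Fin n) → Injective _≡_ _≡_ f → Fin n ↔ Fin n
injective⇒↔ f f-injective = mk↔ₛ′ f f⁻¹ (proj₂ ∘ onto) (λ x → f-injective (proj₂ (onto (f x))))
  where
  onto = injective⇒surjective f-injective
  f⁻¹ = proj₁ ∘ onto

record BFSTree (H : Graph k) : Set where
  field
    parent      : Fin k → Fin k
    parent<     : ∀ {w} → 0 < toℕ w → toℕ (parent w) < toℕ w
    parent-adj  : ∀ {w} → 0 < toℕ w → adj H w (parent w) ≡ true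
    parent-mono : ∀ {v w} → toℕ v ≤ toℕ w → toℕ (parent v) ≤ toℕ (parent w)

module BreadthFirstSearch {n : ℕ} (G : Graph (suc n)) where

  Visited : ℕ → (Fin (suc n) → Fin (suc n)) → Pred (Fin (suc n)) _
  Visited t vertex y = ∃ λ s → toℕ s < t × vertex s ≡ y

  visited? : ∀ t vertex → Decidable (Visited t vertex)
  visited? t vertex y = Finₚ.any? (λ s → (toℕ s <? t) ×-dec (vertex s Finₚ.≟ y))

  -- The first t vertices reached by a breadth-first search from vertex zero:
  -- the s-th vertex reached was discovered from the parent-th one, and the
  -- vertices before head have been fully explored.
  record Search (t : ℕ) : Set where
    field
      vertex           : Fin (suc n) → Fin (suc n)
      parent           : Fin (suc n) → Fin (suc n)
      head             : ℕ
      vertex-injective : ∀ {s s′} → toℕ s < t → toℕ s′ < t → vertex s ≡ vertex s′ → s ≡ s′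
      parent<          : ∀ {w} → 0 < toℕ w → toℕ w < t → toℕ (parent w) < toℕ w
      parent-adj       : ∀ {w} → 0 < toℕ w → toℕ w < t → adj G (vertex w) (vertex (parent w)) ≡ true
      parent-mono      : ∀ {v w} → toℕ v ≤ toℕ w → toℕ w < t → toℕ (parent v) ≤ toℕ (parent w)
      parent≤head      : ∀ {w} → toℕ w < t → toℕ (parent w) ≤ head
      head-explored    : ∀ {s y} → toℕ s < head → adj G (vertex s) y ≡ true → Visited t vertex y

  start : Search 1
  start = record
    { vertex           = const zero
    ; parent           = const zero
    ; head             = 0
    ; vertex-injective = λ s<1 s′<1 _ → toℕ-injective (≡.trans (n<1⇒n≡0 s<1) (≡.sym (n<1⇒n≡0 s′<1)))
    ; parent<          = λ 0<w w<1 → ⊥-elim (<⇒≱ w<1 0<w)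
    ; parent-adj       = λ 0<w w<1 → ⊥-elim (<⇒≱ w<1 0<w)
    ; parent-mono      = λ _ _ → z≤n
    ; parent≤head      = λ _ → z≤n
    ; head-explored    = λ ()
    }

  module _ {t} (S : Search t) where
    open Search S

    Frontier : Pred (Fin (suc n)) _
    Frontier s = ∃ λ y → adj G (vertex s) y ≡ true × ¬ Visited t vertex y

    frontier? : Decidable Frontier
    frontier? s = Finₚ.any? (λ y → (adj G (vertex s) y Boolₚ.≟ true) ×-dec ¬? (visited? t vertex y))

    unvisited : t < suc n → ∃ λ x → ¬ Visited t vertex x
    unvisited t<k = Finₚ.¬∀⟶∃¬ _ _ (visited? t vertex) λ all-visited →
      <⇒≱ t<k (Finₚ.injective⇒≤ {f = index all-visited} (index-injective all-visited))
      where
      index : (∀ y → Visited t vertex y) → Fin (suc n) → Fin t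
      index all y = fromℕ< (proj₁ (proj₂ (all y)))
      index-injective : ∀ all {x y} → index all x ≡ index all y → x ≡ y
      index-injective all {x} {y} same with all x | all y
      ... | s , s<t , sx | s′ , s′<t , s′y = ≡.trans (≡.sym sx) (≡.trans (cong vertex s≡s′) s′y)
        where
        s≡s′ : s ≡ s′
        s≡s′ = toℕ-injective (≡.trans (≡.sym (toℕ-fromℕ< s<t)) (≡.trans (cong toℕ same) (toℕ-fromℕ< s′<t)))

    module Extend (t<k : t < suc n) {m u : Fin (suc n)} (m<t : toℕ m < t) (head≤m : head ≤ toℕ m)
                  (m-u : adj G (vertex m) u ≡ true) (u-new : ¬ Visited t vertex u)
                  (m-least : ∀ {s} → toℕ s < toℕ m → ¬ Frontier s) where

      new : Fin (suc n)
      new = fromℕ< t<k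

      index-cases : ∀ {i} → toℕ i < suc t → toℕ i < t ⊎ i ≡ new
      index-cases i<1+t with m<1+n⇒m<n∨m≡n i<1+t
      ... | inj₁ i<t = inj₁ i<t
      ... | inj₂ i≡t = inj₂ (toℕ-injective (≡.trans i≡t (≡.sym (toℕ-fromℕ< t<k))))

      update-old : ∀ {A : Set} (xs : Fin (suc n) → A) {a i} → toℕ i < t → updateAt xs new (const a) i ≡ xs i
      update-old xs {i = i} i<t = updateAt-minimal i new xs λ { refl → <-irrefl (toℕ-fromℕ< t<k) i<t }

      update-new : ∀ {A : Set} (xs : Fin (suc n) → A) {a} → updateAt xs new (const a) new ≡ a
      update-new xs = updateAt-updates new xs

      vertex′ parent′ : Fin (suc n) → Fin (suc n)
      vertex′ = updateAt vertex new (const u)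
      parent′ = updateAt parent new (const m)

      vertex′-injective : ∀ {s s′} → toℕ s < suc t → toℕ s′ < suc t → vertex′ s ≡ vertex′ s′ → s ≡ s′
      vertex′-injective s< s′< same with index-cases s< | index-cases s′<
      ... | inj₁ s<t | inj₁ s′<t = vertex-injective s<t s′<t
                                     (≡.trans (≡.sym (update-old vertex s<t)) (≡.trans same (update-old vertex s′<t)))
      ... | inj₂ refl | inj₂ refl = refl
      ... | inj₁ s<t | inj₂ refl =
        ⊥-elim (u-new (_ , s<t , ≡.trans (≡.sym (update-old vertex s<t)) (≡.trans same (update-new vertex))))
      ... | inj₂ refl | inj₁ s′<t =
        ⊥-elim (u-new (_ , s′<t , ≡.trans (≡.sym (update-old vertex s′<t)) (≡.trans (≡.sym same) (update-new vertex))))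

      parent′< : ∀ {w} → 0 < toℕ w → toℕ w < suc t → toℕ (parent′ w) < toℕ w
      parent′< 0<w w< with index-cases w<
      ... | inj₁ w<t  rewrite update-old parent {m} w<t = parent< 0<w w<t
      ... | inj₂ refl rewrite update-new parent {m} | toℕ-fromℕ< t<k = m<t

      parent′-adj : ∀ {w} → 0 < toℕ w → toℕ w < suc t → adj G (vertex′ w) (vertex′ (parent′ w)) ≡ true
      parent′-adj 0<w w< with index-cases w<
      ... | inj₁ w<t  rewrite update-old parent {m} w<t | update-old vertex {u} w<t
                            | update-old vertex {u} (<-trans (parent< 0<w w<t) w<t) = parent-adj 0<w w<t
      ... | inj₂ refl rewrite update-new parent {m} | update-new vertex {u} | update-old vertex {u} m<t =
                            ≡.trans (Graph.sym G u (vertex m)) m-u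

      parent′≤m : ∀ {w} → toℕ w < suc t → toℕ (parent′ w) ≤ toℕ m
      parent′≤m w< with index-cases w<
      ... | inj₁ w<t  rewrite update-old parent {m} w<t = ≤-trans (parent≤head w<t) head≤m
      ... | inj₂ refl rewrite update-new parent {m} = ≤-refl

      parent′-mono : ∀ {v w} → toℕ v ≤ toℕ w → toℕ w < suc t → toℕ (parent′ v) ≤ toℕ (parent′ w)
      parent′-mono v≤w w< with index-cases w<
      ... | inj₁ w<t  rewrite update-old parent {m} w<t | update-old parent {m} (≤-<-trans v≤w w<t) = parent-mono v≤w w<t
      ... | inj₂ refl rewrite update-new parent {m} = parent′≤m (≤-<-trans v≤w w<)

      m-explored : ∀ {s y} → toℕ s < toℕ m → adj G (vertex′ s) y ≡ true → Visited (suc t) vertex′ y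
      m-explored {s} {y} s<m sy with visited? t vertex y
      ... | yes (s′ , s′<t , s′y) = s′ , m<n⇒m<1+n s′<t , ≡.trans (update-old vertex s′<t) s′y
      ... | no  y-new = ⊥-elim (m-least s<m (y , s-y , y-new))
        where
        s-y : adj G (vertex s) y ≡ true
        s-y = ≡.trans (cong (λ x → adj G x y) (≡.sym (update-old vertex (<-trans s<m m<t)))) sy

      extended : Search (suc t)
      extended = record
        { vertex           = vertex′
        ; parent           = parent′
        ; head             = toℕ m
        ; vertex-injective = vertex′-injective
        ; parent<          = parent′<
        ; parent-adj       = parent′-adj
        ; parent-mono      = parent′-mono
        ; parent≤head      = parent′≤m
        ; head-explored    = m-explored
        }

    advance : Connected G → 0 < t → t < suc n → Search (suc t)
    advance connected 0<t t<k
      with x , x-new ← unvisited t<k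
      with _ , d , (s , s<t , sc) , d-new , cd
             ← Reach-crossing (visited? t vertex) (zero , 0<t , refl) x-new (connected (vertex zero) x)
      with m , m≤s , (u , m-u , u-new) , m-least
             ← leastWitness frontier? {s} (d , subst (λ z → adj G z d ≡ true) (≡.sym sc) cd , d-new)
      = Extend.extended t<k (≤-<-trans m≤s s<t) (≮⇒≥ λ m<head → u-new (head-explored m<head m-u)) m-u u-new m-least

  search : Connected G → ∀ t → t < suc n → Search (suc t)
  search connected zero    _   = start
  search connected (suc t) t<k = advance (search connected t (<-trans (n<1+n t) t<k)) connected (s≤s z≤n) t<k

bfsTree : {G : Graph (suc n)} → Connected G → Σ (Fin (suc n) ↔ Fin (suc n)) λ π → BFSTree (relabel G (Inverse.to π))
bfsTree {n} {G} connected = injective⇒↔ vertex (vertex-injective (toℕ<n _) (toℕ<n _)) , record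
  { parent      = parent
  ; parent<     = λ 0<w → parent< 0<w (toℕ<n _)
  ; parent-adj  = λ 0<w → parent-adj 0<w (toℕ<n _)
  ; parent-mono = λ v≤w → parent-mono v≤w (toℕ<n _)
  }
  where open BreadthFirstSearch.Search (BreadthFirstSearch.search G connected n ≤-refl)

-- Encoding connected graphs

-- the parents in vertex order, and the non-tree edges
Code : ℕ → Set
Code k = List ℕ × List (Fin k × Fin k)

code≟ : DecidableEquality (Code k)
code≟ = ×.≡-dec (Listₚ.≡-dec _≟_) (Listₚ.≡-dec pair≟)

module _ {H : Graph k} (T : BFSTree H) where
  open BFSTree T

  IsTreeEdge : Fin k × Fin k → Set
  IsTreeEdge (i , j) = j ≡ parent i

  treeEdge? : Decidable IsTreeEdge
  treeEdge? (i , j) = j Finₚ.≟ parent i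

  extraEdges : List (Fin k × Fin k)
  extraEdges = filter (¬? ∘ treeEdge?) (edges H)

  code : Code k
  code = tabulate (toℕ ∘ parent) , extraEdges

  lowerAdj⇔ : ∀ {i j} → toℕ j < toℕ i → adj H i j ≡ true ⇔ (j ≡ parent i ⊎ (i , j) ∈ extraEdges)
  lowerAdj⇔ {i} {j} j<i = mk⇔ to from
    where
    to : adj H i j ≡ true → j ≡ parent i ⊎ (i , j) ∈ extraEdges
    to ij with treeEdge? (i , j)
    ... | yes tree = inj₁ tree
    ... | no ¬tree = inj₂ (∈-filter⁺ (¬? ∘ treeEdge?) (∈-edges⁺ {G = H} (j<i , ij)) ¬tree)
    from : j ≡ parent i ⊎ (i , j) ∈ extraEdges → adj H i j ≡ true
    from (inj₁ tree)  = subst (λ p → adj H i p ≡ true) (≡.sym tree) (parent-adj (≤-<-trans z≤n j<i))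
    from (inj₂ extra) = proj₂ (∈-edges⁻ {G = H} (proj₁ (∈-filter⁻ (¬? ∘ treeEdge?) {xs = edges H} extra)))

code-injective : {H₁ H₂ : Graph k} (T₁ : BFSTree H₁) (T₂ : BFSTree H₂) →
  code T₁ ≡ code T₂ → ∀ i j → adj H₁ i j ≡ adj H₂ i j
code-injective {H₁ = H₁} {H₂} T₁ T₂ same = lowerAdj⇒≗ {G = H₁} {H = H₂} λ {i} {j} j<i →
  Boolₚ.⇔→≡ (⇔.trans (subst (_ ⇔_) (same-decoding i j) (lowerAdj⇔ T₁ j<i)) (⇔.sym (lowerAdj⇔ T₂ j<i)))
  where
  same-parent : ∀ i → BFSTree.parent T₁ i ≡ BFSTree.parent T₂ i
  same-parent i = Finₚ.toℕ-injective (tabulate-injective (cong proj₁ same) i)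
  same-decoding : ∀ i j → (j ≡ BFSTree.parent T₁ i ⊎ (i , j) ∈ extraEdges T₁)
                        ≡ (j ≡ BFSTree.parent T₂ i ⊎ (i , j) ∈ extraEdges T₂)
  same-decoding i j = ≡.cong₂ (λ p X → j ≡ p ⊎ (i , j) ∈ X) (same-parent i) (cong proj₂ same)

module _ {n} {H : Graph (suc n)} (T : BFSTree H) where
  open BFSTree T

  parents∈sortedLists : proj₁ (code T) ∈ sortedLists 0 n (suc n)
  parents∈sortedLists = subst (λ l → proj₁ (code T) ∈ sortedLists 0 n l) (Listₚ.length-tabulate (toℕ ∘ parent))
    (∈-sortedLists⁺ (AllPairs⇒Linked (All.universal (λ _ → z≤n) _ ∷ AllPairsₚ.tabulate⁺-< (parent-mono ∘ <⇒≤)))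
                    (tabulate⁺ (λ i → ≤-pred (Finₚ.toℕ<n (parent i)))))

  length-extraEdges+n≤edgeCount : length (extraEdges T) + n ≤ edgeCount H
  length-extraEdges+n≤edgeCount = begin
    length (extraEdges T) + n                          ≤⟨ +-monoʳ-≤ (length (extraEdges T)) n≤treeEdges ⟩
    length (extraEdges T) + length treeEdges            ≡⟨ +-comm (length (extraEdges T)) _ ⟩
    length treeEdges + length (extraEdges T)            ≡⟨ length-filter+length-filter-∁ (treeEdge? T) (edges H) ⟩
    length (edges H)                                    ≡⟨ edgeCount≡length-edges H ⟨
    edgeCount H                                         ∎
    where
    open ≤-Reasoning
    treeEdges = filter (treeEdge? T) (edges H)
    edgeTo : Fin n → Fin (suc n) × Fin (suc n)
    edgeTo w = suc w , parent (suc w)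
    edgeTo-injective : ∀ {v w} → edgeTo v ≡ edgeTo w → v ≡ w
    edgeTo-injective = Finₚ.suc-injective ∘ proj₁ ∘ ×.,-injective
    edgeTo-∈ : ∀ {e} → e ∈ map edgeTo (allFin n) → e ∈ treeEdges
    edgeTo-∈ e∈ with w , _ , refl ← ∈-map⁻ edgeTo e∈ =
      ∈-filter⁺ (treeEdge? T) (∈-edges⁺ {G = H} (parent< (s≤s z≤n) , parent-adj (s≤s z≤n))) refl
    n≤treeEdges : n ≤ length treeEdges
    n≤treeEdges = begin
      n                                ≡⟨ length-allFin n ⟨
      length (allFin n)                ≡⟨ length-map edgeTo (allFin n) ⟨
      length (map edgeTo (allFin n))   ≤⟨ Unique⇒length≤ pair≟ (Unique.map⁺ edgeTo-injective (Unique.allFin⁺ n)) edgeTo-∈ ⟩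
      length treeEdges                 ∎

allPairs : (k : ℕ) → List (Fin k × Fin k)
allPairs k = cartesianProduct (allFin k) (allFin k)

extraEdgeLists : (k : ℕ) → List (List (Fin k × Fin k))
extraEdgeLists k = concatMap (λ m → lists m (allPairs k)) (filter (λ m → k ^ m <? 4 ^ k) (upTo (2 * k)))

∈-extraEdgeLists⁺ : (X : List (Fin k × Fin k)) → length X < 2 * k → k ^ length X < 4 ^ k → X ∈ extraEdgeLists k
∈-extraEdgeLists⁺ X m<2k few = ∈-concatMap⁺ (λ m → lists m (allPairs _))
  (lose (∈-filter⁺ (λ m → _ ^ m <? _) (∈-upTo⁺ m<2k) few)
        (∈-lists⁺ (All.universal (λ _ → ∈-cartesianProduct⁺ (∈-allFin _) (∈-allFin _)) X)))

length-extraEdgeLists≤ : ∀ k → length (extraEdgeLists k) ≤ 2 * k * 16 ^ k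
length-extraEdgeLists≤ k = begin
  length (extraEdgeLists k)   ≤⟨ length-concatMap≤ (λ m → lists m (allPairs k)) (16 ^ k) lists≤ ⟩
  length few * 16 ^ k         ≤⟨ *-monoˡ-≤ (16 ^ k) (≤-trans (length-filter _ (upTo (2 * k))) (≤-reflexive (Listₚ.length-upTo (2 * k)))) ⟩
  2 * k * 16 ^ k              ∎
  where
  open ≤-Reasoning
  few = filter (λ m → k ^ m <? 4 ^ k) (upTo (2 * k))
  lists≤ : ∀ {m} → m ∈ few → length (lists m (allPairs k)) ≤ 16 ^ k
  lists≤ {m} m∈ = begin
    length (lists m (allPairs k))  ≡⟨ length-lists m (allPairs k) ⟩
    length (allPairs k) ^ m        ≡⟨ cong (_^ m) (length-cartesianProductWith _,_ (allFin k) (allFin k)) ⟩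
    (length (allFin k) * length (allFin k)) ^ m ≡⟨ cong (λ l → (l * l) ^ m) (length-allFin k) ⟩
    (k * k) ^ m                    ≡⟨ ^-distribʳ-* k k m ⟩
    k ^ m * k ^ m                  ≤⟨ *-mono-≤ (<⇒≤ km<4k) (<⇒≤ km<4k) ⟩
    4 ^ k * 4 ^ k                  ≡⟨ ^-distribʳ-* 4 4 k ⟨
    16 ^ k                         ∎
    where
    km<4k = proj₂ (∈-filter⁻ (λ m → k ^ m <? 4 ^ k) {xs = upTo (2 * k)} m∈)

codes : (n : ℕ) → List (Code (suc n))
codes n = cartesianProduct (sortedLists 0 n (suc n)) (extraEdgeLists (suc n))

length-codes≤ : ∀ n → length (codes n) ≤ suc n * 64 ^ suc n
length-codes≤ n = begin
  length (codes n)                                           ≡⟨ length-cartesianProductWith _,_ (sortedLists 0 n (suc n)) _ ⟩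
  length (sortedLists 0 n (suc n)) * length (extraEdgeLists (suc n))
    ≤⟨ *-mono-≤ (length-sortedLists≤ 0 n (suc n)) (length-extraEdgeLists≤ (suc n)) ⟩
  2 ^ (n + suc n) * (2 * suc n * 16 ^ suc n)                 ≡⟨ regroup (2 ^ (n + suc n)) (suc n) (16 ^ suc n) ⟩
  suc n * (2 ^ (suc n + suc n) * 16 ^ suc n)                ≡⟨ cong (λ x → suc n * (x * 16 ^ suc n)) 2^[k+k]≡4^k ⟩
  suc n * (4 ^ suc n * 16 ^ suc n)                           ≡⟨ cong (suc n *_) (^-distribʳ-* 4 16 (suc n)) ⟨
  suc n * 64 ^ suc n                                         ∎
  where
  open ≤-Reasoning
  regroup : ∀ a k b → a * (2 * k * b) ≡ k * ((2 * a) * b)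
  regroup = solve-∀
  2^[k+k]≡4^k : 2 ^ (suc n + suc n) ≡ 4 ^ suc n
  2^[k+k]≡4^k = ≡.trans (^-distribˡ-+-* 2 (suc n) (suc n)) (≡.sym (^-distribʳ-* 2 2 (suc n)))

extraEdgeCount<2k : ∀ {n m} (G : Graph (suc n)) → m + n ≤ edgeCount G → suc n ^ m < 4 ^ suc n → m < 2 * suc n
-- edgeCount of a one-vertex graph computes to 0
extraEdgeCount<2k {zero}  {m} G m≤0 _   = ≤-<-trans (≤-trans (m≤m+n m 0) m≤0) (s≤s z≤n)
extraEdgeCount<2k {suc n}     G _   few = ^<4^⇒< (s≤s (s≤s z≤n)) few

module _ {n : ℕ} where

  codeOf : (G : Graph (suc n)) → Connected G → Code (suc n)
  codeOf G connected = code (proj₂ (bfsTree connected))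

  codeOf-injective : ∀ {G H} (cG : Connected G) (cH : Connected H) → codeOf G cG ≡.≡ codeOf H cH → Iso G H
  codeOf-injective {G} {H} cG cH same =
    relabelings⇒Iso G H (proj₁ (bfsTree cG)) (proj₁ (bfsTree cH))
      (code-injective (proj₂ (bfsTree cG)) (proj₂ (bfsTree cH)) same)

  codeOf-∈-codes : ∀ {G} (counted : Counted G) → codeOf G (proj₁ counted) ∈ codes n
  codeOf-∈-codes {G} (connected , bounded) =
    ∈-cartesianProduct⁺ (parents∈sortedLists T)
      (∈-extraEdgeLists⁺ (extraEdges T) (extraEdgeCount<2k G m+n≤e k^m<4^k) k^m<4^k)
    where
    π = proj₁ (bfsTree connected)
    T = proj₂ (bfsTree connected)
    m = length (extraEdges T)
    m+n≤e : m + n ≤ edgeCount G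
    m+n≤e = ≤-trans (length-extraEdges+n≤edgeCount T)
                    (Iso⇒edgeCount≤ {G = relabel G (Inverse.to π)} {H = G} (Iso-relabel G π))
    k^m<4^k : suc n ^ m < 4 ^ suc n
    k^m<4^k = ≤-<-trans (^-monoʳ-≤ (suc n) (≤-trans (≤-reflexive (≡.sym (m+n∸n≡m m n))) (∸-monoˡ-≤ n m+n≤e)))
                        (LtExp⇒<4^ bounded)

lemma2p1 : (k : ℕ) → k ≥ 1 → (Gs : List (Graph k)) →
    All Counted Gs → AllPairs (λ G H → ¬ Iso G H) Gs →
    length Gs < 100 ^ k
lemma2p1 (suc n) _ Gs counted non-isomorphic = begin-strict
  length Gs           ≤⟨ labelling⇒length≤ (λ {G} c → codeOf G (proj₁ c)) code≟
                           (λ c d → codeOf-injective (proj₁ c) (proj₁ d)) codeOf-∈-codes counted non-isomorphic ⟩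
  length (codes n)    ≤⟨ length-codes≤ n ⟩
  suc n * 64 ^ suc n  <⟨ *64^<100^ n ⟩
  100 ^ suc n         ∎
  where open ≤-Reasoning
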